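{- Let $n \ge 1$ and $m\ge 1$. There is a bijection between the set of $n$-mappings with exactly $m$ ascending runs and the set of pairs $(S,x)$ where $S = (S_1,\dots,S_m)$ is a partition of $[n]$ into $m$ non-empty blocks ordered so that $\max(S_1) > \max(S_2) > \dots > \max(S_m)$, and $x = (n_1,\dots,n_m)$ is an integer sequence satisfying, for each $1 \le j \le m$, $$n_j \in [n] \setminus \big\{ \min\{\ell \in S_i : \ell > \max(S_j)\} : 1 \le i \le j-1 \big\}.$$
   Context: $[n]=\{1,\dots,n\}$. An $n$-mapping is a function $f:[n]\to[n]$. An ascending run in $f$ is a maximal ascending sequence $i < f(i) < f^2(i) < \dots < f^k(i)$ (not contained in a longer such sequence); the number of ascending runs of $f$ equals the number of $j\in[n]$ such that every $i$ with $f(i)=j$ satisfies $i \ge j$. -}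

module Defs where

open import Data.Nat as ℕ using (ℕ)
open import Data.Fin using (Fin; _≤_; _<_; _≟_; _≤?_)
open import Data.Fin.Properties using (all?)
open import Data.Fin.Subset using (Subset; _∈_; Nonempty)
open import Data.List using (List; length; filter)
open import Data.List using () renaming (allFin to allFinList)
open import Data.Product using (Σ; ∃; ∃-syntax; _×_; proj₁; proj₂)
open import Data.Product.Relation.Binary.Pointwise.NonDependent using (×-setoid)
open import Relation.Binary using (Setoid)
open import Relation.Binary.PropositionalEquality using (_≡_; _≢_; _→-setoid_)
open import Relation.Nullary.Decidable using (Dec; _→-dec_)
import Relation.Binary.Construct.On as On

-- An n-mapping: a function [n] → [n]  (here Fin n = {0,…,n-1} represents [n],
-- order-preservingly, so all order notions are unaffected).
Mapping : ℕ → Set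
Mapping n = Fin n → Fin n

RunStart : ∀ {n} → Mapping n → Fin n → Set
RunStart {n} f j = ∀ (i : Fin n) → f i ≡ j → j ≤ i

runStart? : ∀ {n} (f : Mapping n) (j : Fin n) → Dec (RunStart f j)
runStart? f j = all? (λ i → (f i ≟ j) →-dec (j ≤? i))

ascRuns : ∀ {n} → Mapping n → ℕ
ascRuns {n} f = length (filter (runStart? f) (allFinList n))

MappingsWithRuns : ℕ → ℕ → Set
MappingsWithRuns n m = Σ (Mapping n) (λ f → ascRuns f ≡ m)

MappingsWithRunsSetoid : ℕ → ℕ → Setoid _ _
MappingsWithRunsSetoid n m =
  On.setoid {B = MappingsWithRuns n m} (Fin n →-setoid Fin n) proj₁

IsMax : ∀ {n} → Subset n → Fin n → Set
IsMax {n} p a = a ∈ p × (∀ (b : Fin n) → b ∈ p → b ≤ a)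

IsMinAbove : ∀ {n} → Subset n → Fin n → Fin n → Set
IsMinAbove {n} p b c = c ∈ p × b < c × (∀ (d : Fin n) → d ∈ p → b < d → c ≤ d)

IsOrderedPartition : ∀ {n m} → (Fin m → Subset n) → Set
IsOrderedPartition {n} {m} S =
  (∀ (j : Fin m) → Nonempty (S j)) ×
  (∀ (ℓ : Fin n) → ∃[ j ] ℓ ∈ S j) ×
  (∀ (j k : Fin m) (ℓ : Fin n) → ℓ ∈ S j → ℓ ∈ S k → j ≡ k) ×
  (∀ (i j : Fin m) (a b : Fin n) → i < j → IsMax (S i) a → IsMax (S j) b → b < a)

IsAdmissible : ∀ {n m} → (Fin m → Subset n) → (Fin m → Fin n) → Set
IsAdmissible {n} {m} S x =
  ∀ (i j : Fin m) (b c : Fin n) → i < j → IsMax (S j) b → IsMinAbove (S i) b c → x j ≢ c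

Pairs : ℕ → ℕ → Set
Pairs n m = Σ ((Fin m → Subset n) × (Fin m → Fin n))
              (λ Sx → IsOrderedPartition (proj₁ Sx) × IsAdmissible (proj₁ Sx) (proj₂ Sx))

PairsSetoid : ℕ → ℕ → Setoid _ _
PairsSetoid n m =
  On.setoid {B = Pairs n m} (×-setoid (Fin m →-setoid Subset n) (Fin m →-setoid Fin n)) proj₁

module Submission where

-- For f : [n] → [n] call ℓ ↦ f ℓ a run step when ℓ < f ℓ and no larger
-- preimage of f ℓ lies below f ℓ.  Run steps chain [n] into runs; every run has
-- one start (RunStart) and one end, so ascRuns f is the number of run ends.
-- The bijection sends f to the pair (S , x) whose blocks are the runs,
-- numbered by decreasing end, with x j the image of the end of run j.
--
-- Instead of computing an inverse and checking both composites, the file uses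
-- the relation "f encodes (S , x)": f moves each element to the next larger
-- element of its block, and the maximum of block j to x j.

open import Defs
open import Data.Nat using (ℕ; _≤_)
open import Function.Bundles using (Bijection)
open import Data.Nat as ℕ using (zero; suc; _+_; z≤n; s≤s)
import Data.Nat.Properties as ℕP
open import Data.Bool using (true; if_then_else_)
open import Data.Fin as F using (Fin; zero; suc; toℕ; fromℕ<; _<_; _>_)
open import Data.Fin.Induction using (>-wellFounded)
open import Induction.WellFounded using (Acc; acc)
open import Data.Fin.Properties
  using (_<?_; _≤?_; _≟_; toℕ-injective; toℕ<n; toℕ-fromℕ<; toℕ-inject; any?; all?; cantor-schröder-bernstein)
open import Data.Fin.Subset using (Subset; _∈_; Nonempty)
open import Data.Fin.Subset.Properties using (_∈?_; ⊆-antisym)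
open import Data.List using (length; filter; tabulate)
import Data.Vec as Vec
import Data.Vec.Properties as VecP
open import Data.Product using (∃; ∃-syntax; _×_; _,_; proj₁; proj₂)
open import Data.Empty using (⊥)
open import Data.Sum using (inj₁; inj₂)
open import Function.Definitions using (Injective)
open import Relation.Nullary using (Dec; yes; no; does; ¬_; contradiction)
open import Relation.Nullary.Decidable using (¬?; _×-dec_; _→-dec_; dec-true)
open import Relation.Unary using (Decidable)
open import Relation.Binary.PropositionalEquality
open import Relation.Binary.Definitions using (tri<; tri≈; tri>)
open import Relation.Binary using (Setoid)

count : ∀ {n} {P : Fin n → Set} → Decidable P → ℕ
count {zero}  P? = 0
count {suc n} P? = (if does (P? zero) then 1 else 0) + count (λ i → P? (suc i))

length-filter-tabulate : ∀ {n} {A : Set} {Q : A → Set} (Q? : Decidable Q) (g : Fin n → A) →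
  length (filter Q? (tabulate g)) ≡ count (λ i → Q? (g i))
length-filter-tabulate {zero}  Q? g = refl
length-filter-tabulate {suc n} Q? g with Q? (g zero)
... | yes _ = cong suc (length-filter-tabulate Q? (λ i → g (suc i)))
... | no  _ = length-filter-tabulate Q? (λ i → g (suc i))

count-complement : ∀ {n} {P : Fin n → Set} (P? : Decidable P) →
  count P? + count (λ i → ¬? (P? i)) ≡ n
count-complement {zero}  P? = refl
count-complement {suc n} P? with P? zero
... | yes _ = cong suc (count-complement (λ i → P? (suc i)))
... | no  _ = trans (ℕP.+-suc _ _) (cong suc (count-complement (λ i → P? (suc i))))

count-cong : ∀ {n} {P Q : Fin n → Set} (P? : Decidable P) (Q? : Decidable Q) →
  (∀ i → does (P? i) ≡ does (Q? i)) → count P? ≡ count Q?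
count-cong {zero}  P? Q? eq = refl
count-cong {suc n} P? Q? eq =
  cong₂ _+_ (cong (λ b → if b then 1 else 0) (eq zero)) (count-cong _ _ (λ i → eq (suc i)))

-- rank P? e = #{ k | e < k and P k }: the position of e when the P-elements
-- are listed in decreasing order, starting from 0.
rank : ∀ {n} {P : Fin n → Set} → Decidable P → Fin n → ℕ
rank P? e = count (λ k → (e <? k) ×-dec P? k)

rank-zero : ∀ {n} {P : Fin (suc n) → Set} (P? : Decidable P) → rank P? zero ≡ count (λ i → P? (suc i))
rank-zero {n} P? = count-cong (λ k → (zero {n} <? suc k) ×-dec P? (suc k)) (λ k → P? (suc k)) (λ _ → refl)

rank-suc : ∀ {n} {P : Fin (suc n) → Set} (P? : Decidable P) e → rank P? (suc e) ≡ rank (λ i → P? (suc i)) e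
rank-suc P? e = count-cong (λ k → (suc e <? suc k) ×-dec P? (suc k)) (λ k → (e <? k) ×-dec P? (suc k)) (λ _ → refl)

count-tail : ∀ {n} {P : Fin (suc n) → Set} (P? : Decidable P) → count (λ i → P? (suc i)) ℕ.≤ count P?
count-tail P? = ℕP.m≤n+m _ _

rank<count : ∀ {n} {P : Fin n → Set} (P? : Decidable P) {e} → P e → rank P? e ℕ.< count P?
rank<count {suc n} P? {zero} pe with P? zero
... | yes _ = s≤s (ℕP.≤-reflexive (rank-zero P?))
... | no ¬pe = contradiction pe ¬pe
rank<count {suc n} P? {suc e} pe = begin-strict
  rank P? (suc e)                 ≡⟨ rank-suc P? e ⟩
  rank (λ i → P? (suc i)) e       <⟨ rank<count (λ i → P? (suc i)) pe ⟩
  count (λ i → P? (suc i))        ≤⟨ count-tail P? ⟩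
  count P?                        ∎
  where open ℕP.≤-Reasoning

rank-surjective : ∀ {n} {P : Fin n → Set} (P? : Decidable P) {r} → r ℕ.< count P? →
  ∃[ e ] P e × rank P? e ≡ r
rank-surjective {suc n} P? {r} r<count with P? zero
... | no _ = let (e , pe , re) = rank-surjective (λ i → P? (suc i)) r<count
             in suc e , pe , trans (rank-suc P? e) re
... | yes p0 with ℕP.m≤n⇒m<n∨m≡n (ℕP.≤-pred r<count)
...   | inj₁ r<tail = let (e , pe , re) = rank-surjective (λ i → P? (suc i)) r<tail
                      in suc e , pe , trans (rank-suc P? e) re
...   | inj₂ r≡tail = zero , p0 , trans (rank-zero P?) (sym r≡tail)

rank-antitone : ∀ {n} {P : Fin n → Set} (P? : Decidable P) {a b} → P b → a < b → rank P? b ℕ.< rank P? a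
rank-antitone {suc n} P? {zero} {suc b} pb _ = begin-strict
  rank P? (suc b)                 ≡⟨ rank-suc P? b ⟩
  rank (λ i → P? (suc i)) b       <⟨ rank<count (λ i → P? (suc i)) pb ⟩
  count (λ i → P? (suc i))        ≡⟨ rank-zero P? ⟨
  rank P? zero                    ∎
  where open ℕP.≤-Reasoning
rank-antitone {suc n} P? {suc a} {suc b} pb (s≤s a<b) = begin-strict
  rank P? (suc b)                 ≡⟨ rank-suc P? b ⟩
  rank (λ i → P? (suc i)) b       <⟨ rank-antitone (λ i → P? (suc i)) pb a<b ⟩
  rank (λ i → P? (suc i)) a       ≡⟨ rank-suc P? a ⟨
  rank P? (suc a)                 ∎
  where open ℕP.≤-Reasoning

rank-injective : ∀ {n} {P : Fin n → Set} (P? : Decidable P) {a b} → P a → P b →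
  rank P? a ≡ rank P? b → a ≡ b
rank-injective P? {a} {b} pa pb eq with ℕP.<-cmp (toℕ a) (toℕ b)
... | tri< a<b _ _ = contradiction (sym eq) (ℕP.<⇒≢ (rank-antitone P? pb a<b))
... | tri≈ _ a≡b _ = toℕ-injective a≡b
... | tri> _ _ b<a = contradiction eq (ℕP.<⇒≢ (rank-antitone P? pa b<a))

rank-<⇒> : ∀ {n} {P : Fin n → Set} (P? : Decidable P) {a b} → P a → P b → rank P? a ℕ.< rank P? b → b < a
rank-<⇒> P? {a} {b} pa pb ra<rb with ℕP.<-cmp (toℕ a) (toℕ b)
... | tri< a<b _ _ = contradiction ra<rb (ℕP.<⇒≯ (rank-antitone P? pb a<b))
... | tri≈ _ a≡b _ = contradiction (cong (rank P?) (toℕ-injective a≡b)) (ℕP.<⇒≢ ra<rb)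
... | tri> _ _ b<a = b<a

module _ {n} {P : Fin n → Set} (P? : Decidable P) where

  enumerate : Fin (count P?) → Fin n
  enumerate r = proj₁ (rank-surjective P? (toℕ<n r))

  enumerate-∈ : ∀ r → P (enumerate r)
  enumerate-∈ r = proj₁ (proj₂ (rank-surjective P? (toℕ<n r)))

  rank-enumerate : ∀ r → rank P? (enumerate r) ≡ toℕ r
  rank-enumerate r = proj₂ (proj₂ (rank-surjective P? (toℕ<n r)))

  enumerate-injective : Injective _≡_ _≡_ enumerate
  enumerate-injective {r} {s} eq =
    toℕ-injective (trans (sym (rank-enumerate r)) (trans (cong (rank P?) eq) (rank-enumerate s)))

  enumerate-onto : ∀ {e} → P e → ∃[ r ] enumerate r ≡ e
  enumerate-onto pe = r , rank-injective P? (enumerate-∈ r) pe (trans (rank-enumerate r) (toℕ-fromℕ< _))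
    where
    r : Fin (count P?)
    r = fromℕ< (rank<count P? pe)

  -- A repetition-free listing g : Fin k → Fin n of exactly the P-elements has
  -- length count P?  (comparing it with enumerate gives injections both ways).
  count-enumerated : ∀ {k} (g : Fin k → Fin n) → (∀ i → P (g i)) → Injective _≡_ _≡_ g →
    (∀ {e} → P e → ∃[ i ] g i ≡ e) → count P? ≡ k
  count-enumerated {k} g inP g-inj onto = cantor-schröder-bernstein {f = index} {g = position} index-inj position-inj
    where
    index : Fin (count P?) → Fin k
    index r = proj₁ (onto (enumerate-∈ r))
    index-inj : Injective _≡_ _≡_ index
    index-inj eq = enumerate-injective (trans (sym (proj₂ (onto _))) (trans (cong g eq) (proj₂ (onto _))))
    position : Fin k → Fin (count P?)
    position i = proj₁ (enumerate-onto (inP i))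
    position-inj : Injective _≡_ _≡_ position
    position-inj {i} {j} eq = g-inj (trans (sym (proj₂ (enumerate-onto (inP i)))) (trans (cong enumerate eq) (proj₂ (enumerate-onto (inP j)))))

count-transfer : ∀ {n n′} {P : Fin n → Set} {Q : Fin n′ → Set} (P? : Decidable P) (Q? : Decidable Q)
  (h : Fin n → Fin n′) → (∀ {e} → P e → Q (h e)) → (∀ {a b} → P a → P b → h a ≡ h b → a ≡ b) →
  (∀ {v} → Q v → ∃[ e ] P e × h e ≡ v) → count Q? ≡ count P?
count-transfer {Q = Q} P? Q? h PQ h-inj h-onto =
  count-enumerated Q? (λ r → h (enumerate P? r)) (λ r → PQ (enumerate-∈ P? r))
    (λ eq → enumerate-injective P? (h-inj (enumerate-∈ P? _) (enumerate-∈ P? _) eq)) onto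
  where
  onto : ∀ {v} → Q v → ∃[ r ] h (enumerate P? r) ≡ v
  onto qv = let (e , pe , he≡v) = h-onto qv; (r , er≡e) = enumerate-onto P? pe in r , trans (cong h er≡e) he≡v

largest : ∀ {n} {P : Fin n → Set} → Decidable P → ∀ {i} → P i → ∃[ a ] P a × (∀ b → P b → b F.≤ a)
largest {suc n} {P} P? {i} pi with any? (λ b → P? (suc b))
... | yes (b , pb) = let (a , pa , above) = largest (λ b → P? (suc b)) pb in
  suc a , pa , λ { zero _ → z≤n ; (suc b) pb → s≤s (above b pb) }
... | no none = zero , only-zero i pi , λ { zero _ → z≤n ; (suc b) pb → contradiction (b , pb) none }
  where
  only-zero : ∀ i → P i → P zero
  only-zero zero    pi = pi
  only-zero (suc i) pi = contradiction (i , pi) none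

smallest : ∀ {n} {P : Fin n → Set} → Decidable P → ∀ {i} → P i → ∃[ a ] P a × (∀ b → P b → a F.≤ b)
smallest {suc n} P? {i} pi with P? zero | i
... | yes p0 | _      = zero , p0 , λ _ _ → z≤n
... | no ¬p0 | zero   = contradiction pi ¬p0
... | no ¬p0 | suc i′ = let (a , pa , below) = smallest (λ b → P? (suc b)) pi in
  suc a , pa , λ { zero p0 → contradiction p0 ¬p0 ; (suc b) pb → s≤s (below b pb) }

module _ {n : ℕ} where

  isMax? : (p : Subset n) → Decidable (IsMax p)
  isMax? p a = (a ∈? p) ×-dec all? (λ b → (b ∈? p) →-dec (b ≤? a))

  maximum : (p : Subset n) → Nonempty p → ∃ (IsMax p)
  maximum p (a , a∈p) = let (b , b∈p , above) = largest (_∈? p) a∈p in b , b∈p , above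

  max-unique : ∀ {p : Subset n} {a a′} → IsMax p a → IsMax p a′ → a ≡ a′
  max-unique (a∈p , a-max) (a′∈p , a′-max) = toℕ-injective (ℕP.≤-antisym (a′-max _ a∈p) (a-max _ a′∈p))

  minAbove-exists : ∀ {p : Subset n} {ℓ} → ℓ ∈ p → ¬ IsMax p ℓ → ∃ (IsMinAbove p ℓ)
  minAbove-exists {p} {ℓ} ℓ∈p not-max with any? (λ b → (b ∈? p) ×-dec (ℓ <? b))
  ... | no none = contradiction (ℓ∈p , λ b b∈p → ℕP.≮⇒≥ (λ ℓ<b → none (b , b∈p , ℓ<b))) not-max
  ... | yes (b , above) = let (c , (c∈p , ℓ<c) , least) = smallest (λ d → (d ∈? p) ×-dec (ℓ <? d)) above in
    c , c∈p , ℓ<c , λ d d∈p ℓ<d → least d (d∈p , ℓ<d)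

  minAbove-unique : ∀ {p : Subset n} {b c c′} → IsMinAbove p b c → IsMinAbove p b c′ → c ≡ c′
  minAbove-unique (c∈p , b<c , c-least) (c′∈p , b<c′ , c′-least) =
    toℕ-injective (ℕP.≤-antisym (c-least _ c′∈p b<c′) (c′-least _ c∈p b<c))

subsetOf : ∀ {n} {P : Fin n → Set} → Decidable P → Subset n
subsetOf P? = Vec.tabulate (λ ℓ → does (P? ℓ))

module _ {n} {P : Fin n → Set} (P? : Decidable P) where

  ∈-subsetOf : ∀ {ℓ} → ℓ ∈ subsetOf P? → P ℓ
  ∈-subsetOf {ℓ} ℓ∈ = from-does (P? ℓ) (trans (sym (VecP.lookup∘tabulate _ ℓ)) (VecP.[]=⇒lookup ℓ∈))
    where
    from-does : ∀ {A : Set} (a? : Dec A) → does a? ≡ true → A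
    from-does (yes a) _ = a

  subsetOf-∈ : ∀ {ℓ} → P ℓ → ℓ ∈ subsetOf P?
  subsetOf-∈ {ℓ} pℓ = VecP.lookup⇒[]= ℓ _ (trans (VecP.lookup∘tabulate _ ℓ) (dec-true (P? ℓ) pℓ))

-- This is the inverse of the bijection; everything below is organised around it.
record Encodes {n m} (f : Mapping n) (S : Fin m → Subset n) (x : Fin m → Fin n) : Set where
  field
    at-max    : ∀ {j ℓ} → IsMax (S j) ℓ → f ℓ ≡ x j
    below-max : ∀ {j ℓ} → ℓ ∈ S j → ¬ IsMax (S j) ℓ → IsMinAbove (S j) ℓ (f ℓ)

open Encodes

module _ {n m} {S : Fin m → Subset n} {x : Fin m → Fin n} where

  encoding : IsOrderedPartition S → ∃[ f ] Encodes f S x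
  encoding (_ , cover , disjoint , _) = f , record { at-max = f-at-max ; below-max = f-below-max }
    where
    block : Fin n → Fin m
    block ℓ = proj₁ (cover ℓ)
    in-block : ∀ ℓ → ℓ ∈ S (block ℓ)
    in-block ℓ = proj₂ (cover ℓ)
    f : Mapping n
    f ℓ with isMax? (S (block ℓ)) ℓ
    ... | yes _      = x (block ℓ)
    ... | no not-max = proj₁ (minAbove-exists (in-block ℓ) not-max)
    f-at-max : ∀ {j ℓ} → IsMax (S j) ℓ → f ℓ ≡ x j
    f-at-max {j} {ℓ} ℓ-max with disjoint _ _ ℓ (in-block ℓ) (proj₁ ℓ-max)
    ... | refl with isMax? (S (block ℓ)) ℓ
    ...   | yes _      = refl
    ...   | no not-max = contradiction ℓ-max not-max
    f-below-max : ∀ {j ℓ} → ℓ ∈ S j → ¬ IsMax (S j) ℓ → IsMinAbove (S j) ℓ (f ℓ)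
    f-below-max {j} {ℓ} ℓ∈S not-max with disjoint _ _ ℓ (in-block ℓ) ℓ∈S
    ... | refl with isMax? (S (block ℓ)) ℓ
    ...   | yes ℓ-max = contradiction ℓ-max not-max
    ...   | no _      = proj₂ (minAbove-exists (in-block ℓ) not-max)

  encoding-unique : (∀ ℓ → ∃[ j ] ℓ ∈ S j) → ∀ {f g} → Encodes f S x → Encodes g S x → ∀ ℓ → f ℓ ≡ g ℓ
  encoding-unique cover enc-f enc-g ℓ with cover ℓ
  ... | j , ℓ∈S with isMax? (S j) ℓ
  ...   | yes ℓ-max  = trans (at-max enc-f ℓ-max) (sym (at-max enc-g ℓ-max))
  ...   | no not-max = minAbove-unique (below-max enc-f ℓ∈S not-max) (below-max enc-g ℓ∈S not-max)

encodes-resp : ∀ {n m} {f g : Mapping n} {S S′ : Fin m → Subset n} {x x′ : Fin m → Fin n} →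
  (∀ ℓ → f ℓ ≡ g ℓ) → (∀ j → S j ≡ S′ j) → (∀ j → x j ≡ x′ j) → Encodes f S x → Encodes g S′ x′
encodes-resp {f = f} {g} {S} {S′} {x} {x′} f≡g S≡S′ x≡x′ enc = record
  { at-max    = λ {j} {ℓ} ℓ-max → trans (sym (f≡g ℓ)) (trans (at-max enc (from-max ℓ-max)) (x≡x′ j))
  ; below-max = λ {j} {ℓ} ℓ∈S′ not-max →
      subst₂ (λ p c → IsMinAbove p ℓ c) (S≡S′ j) (f≡g ℓ)
        (below-max enc (subst (ℓ ∈_) (sym (S≡S′ j)) ℓ∈S′) (λ ℓ-max → not-max (subst (λ p → IsMax p ℓ) (S≡S′ j) ℓ-max)))
  }
  where
  from-max : ∀ {j ℓ} → IsMax (S′ j) ℓ → IsMax (S j) ℓ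
  from-max {j} {ℓ} = subst (λ p → IsMax p ℓ) (sym (S≡S′ j))

module Runs {n} (f : Mapping n) where

  HasNext : Fin n → Set
  HasNext ℓ = ℓ < f ℓ × (∀ i → ℓ < i → i < f ℓ → f i ≢ f ℓ)

  hasNext? : Decidable HasNext
  hasNext? ℓ = (ℓ <? f ℓ) ×-dec all? (λ i → (ℓ <? i) →-dec ((i <? f ℓ) →-dec ¬? (f i ≟ f ℓ)))

  IsEnd : Fin n → Set
  IsEnd ℓ = ¬ HasNext ℓ

  isEnd? : Decidable IsEnd
  isEnd? ℓ = ¬? (hasNext? ℓ)

  data _⇝_ : Fin n → Fin n → Set where
    stop : ∀ {ℓ} → ℓ ⇝ ℓ
    step : ∀ {ℓ e} → HasNext ℓ → f ℓ ⇝ e → ℓ ⇝ e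

  ⇝-≤ : ∀ {ℓ e} → ℓ ⇝ e → ℓ F.≤ e
  ⇝-≤ stop              = ℕP.≤-refl
  ⇝-≤ (step (ℓ<fℓ , _) r) = ℕP.≤-trans (ℕP.<⇒≤ ℓ<fℓ) (⇝-≤ r)

  -- Run steps go strictly up, so every run reaches an end.
  reaches-end : ∀ ℓ → ∃[ e ] ℓ ⇝ e × IsEnd e
  reaches-end ℓ = walk ℓ (>-wellFounded ℓ)
    where
    walk : ∀ ℓ → Acc _>_ ℓ → ∃[ e ] ℓ ⇝ e × IsEnd e
    walk ℓ (acc rec) with hasNext? ℓ
    ... | yes next = let (e , fℓ⇝e , e-end) = walk (f ℓ) (rec (proj₁ next)) in e , step next fℓ⇝e , e-end
    ... | no last  = ℓ , stop , last

  -- Runs are deterministic, so the end reached from ℓ is unique.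
  ends-unique : ∀ {ℓ e e′} → ℓ ⇝ e → ℓ ⇝ e′ → IsEnd e → IsEnd e′ → e ≡ e′
  ends-unique stop       stop        _     _      = refl
  ends-unique stop       (step h _)  e-end _      = contradiction h e-end
  ends-unique (step h _) stop        _     e′-end = contradiction h e′-end
  ends-unique (step _ r) (step _ r′) e-end e′-end = ends-unique r r′ e-end e′-end

  end : Fin n → Fin n
  end ℓ = proj₁ (reaches-end ℓ)

  ⇝end : ∀ ℓ → ℓ ⇝ end ℓ
  ⇝end ℓ = proj₁ (proj₂ (reaches-end ℓ))

  end-isEnd : ∀ ℓ → IsEnd (end ℓ)
  end-isEnd ℓ = proj₂ (proj₂ (reaches-end ℓ))

  end-unique : ∀ {ℓ e} → ℓ ⇝ e → IsEnd e → end ℓ ≡ e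
  end-unique r e-end = ends-unique (⇝end _) r (end-isEnd _) e-end

  end-≥ : ∀ ℓ → ℓ F.≤ end ℓ
  end-≥ ℓ = ⇝-≤ (⇝end ℓ)

  end-of-end : ∀ {ℓ} → IsEnd ℓ → end ℓ ≡ ℓ
  end-of-end = end-unique stop

  end-step : ∀ {ℓ} → HasNext ℓ → end (f ℓ) ≡ end ℓ
  end-step next = sym (end-unique (step next (⇝end _)) (end-isEnd _))

  step-injective : ∀ {a b} → HasNext a → HasNext b → f a ≡ f b → a ≡ b
  step-injective {a} {b} (a<fa , a-last) (b<fb , b-last) fa≡fb with ℕP.<-cmp (toℕ a) (toℕ b)
  ... | tri< a<b _ _ = contradiction (sym fa≡fb) (a-last b a<b (subst (b <_) (sym fa≡fb) b<fb))
  ... | tri≈ _ a≡b _ = toℕ-injective a≡b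
  ... | tri> _ _ b<a = contradiction fa≡fb (b-last a b<a (subst (a <_) fa≡fb a<fa))

  last-preimage : ∀ {i v} → f i ≡ v → i < v → ∃[ p ] HasNext p × f p ≡ v × i F.≤ p
  last-preimage {i} {v} fi≡v i<v with largest (λ p → (f p ≟ v) ×-dec (p <? v)) (fi≡v , i<v)
  ... | p , (fp≡v , p<v) , p-largest = p , (subst (p <_) (sym fp≡v) p<v , p-last) , fp≡v , p-largest i (fi≡v , i<v)
    where
    p-last : ∀ q → p < q → q < f p → f q ≢ f p
    p-last q p<q q<fp fq≡fp = ℕP.<⇒≱ p<q (p-largest q (trans fq≡fp fp≡v , subst (q <_) fp≡v q<fp))

  -- By upward induction on b:
  -- if a < b < f a, then b has a next element f b, and f b = f a contradicts
  -- the choice of a, while f b < f a or f a < f b gives a larger counterexample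
  -- (a , f b) or (b , f a).
  no-skipped : ∀ {a b} → end a ≡ end b → a < b → HasNext a → f a F.≤ b
  no-skipped {a} {b} ea≡eb a<b next-a = ℕP.≮⇒≥ (skips-nothing b (>-wellFounded b) a ea≡eb a<b next-a)
    where
    skips-nothing : ∀ b → Acc _>_ b → ∀ a → end a ≡ end b → a < b → HasNext a → ¬ b < f a
    skips-nothing b (acc rec) a ea≡eb a<b next-a@(_ , a-last) b<fa = by-cases (hasNext? b)
      where
      by-cases : Dec (HasNext b) → ⊥
      by-cases (no b-end) = ℕP.<⇒≱ b<fa (begin
        toℕ (f a)       ≤⟨ end-≥ (f a) ⟩
        toℕ (end (f a)) ≡⟨ cong toℕ (trans (end-step next-a) (trans ea≡eb (end-of-end b-end))) ⟩
        toℕ b           ∎)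
        where open ℕP.≤-Reasoning
      by-cases (yes next-b) with ℕP.<-cmp (toℕ (f b)) (toℕ (f a))
      ... | tri≈ _ fb≡fa _ = a-last b a<b b<fa (toℕ-injective fb≡fa)
      ... | tri< fb<fa _ _ =
            skips-nothing (f b) (rec (proj₁ next-b)) a (trans ea≡eb (sym (end-step next-b))) (ℕP.<-trans a<b (proj₁ next-b)) next-a fb<fa
      ... | tri> _ _ fa<fb =
            skips-nothing (f a) (rec b<fa) b (trans (sym ea≡eb) (sym (end-step next-a))) b<fa next-b fa<fb

  -- Every run has one start and one end, so ascRuns f counts the ends.
  ascRuns≡#ends : ascRuns f ≡ count isEnd?
  ascRuns≡#ends = ℕP.+-cancelˡ-≡ (count hasNext?) _ _ (begin
    count hasNext? + ascRuns f             ≡⟨ cong (_+ ascRuns f) (sym #nonstarts≡#steps) ⟩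
    count nonstart? + ascRuns f            ≡⟨ cong (count nonstart? +_) (length-filter-tabulate (runStart? f) (λ i → i)) ⟩
    count nonstart? + count (runStart? f)  ≡⟨ ℕP.+-comm (count nonstart?) _ ⟩
    count (runStart? f) + count nonstart?  ≡⟨ count-complement (runStart? f) ⟩
    n                                      ≡⟨ count-complement hasNext? ⟨
    count hasNext? + count isEnd?          ∎)
    where
    open ≡-Reasoning
    nonstart? : Decidable (λ v → ¬ RunStart f v)
    nonstart? v = ¬? (runStart? f v)
    -- run steps are in bijection with the non-starts via f
    #nonstarts≡#steps : count nonstart? ≡ count hasNext?
    #nonstarts≡#steps = count-transfer hasNext? nonstart? f
      (λ (ℓ<fℓ , _) start → ℕP.<⇒≱ ℓ<fℓ (start _ refl))
      step-injective
      (λ {v} → lands-on v)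
      where
      lands-on : ∀ v → ¬ RunStart f v → ∃[ p ] HasNext p × f p ≡ v
      lands-on v not-start with any? (λ i → (f i ≟ v) ×-dec (i <? v))
      ... | no none = contradiction (λ i fi≡v → ℕP.≮⇒≥ (λ i<v → none (i , fi≡v , i<v))) not-start
      ... | yes (i , fi≡v , i<v) = let (p , next , fp≡v , _) = last-preimage fi≡v i<v in p , next , fp≡v

module RunPartition {n m} (f : Mapping n) (runs : ascRuns f ≡ m) where
  open Runs f

  #ends≡m : count isEnd? ≡ m
  #ends≡m = trans (sym ascRuns≡#ends) runs

  runIndex : Fin n → ℕ
  runIndex ℓ = rank isEnd? (end ℓ)

  blocks : Fin m → Subset n
  blocks j = subsetOf (λ ℓ → runIndex ℓ ℕ.≟ toℕ j)

  ∈blocks : ∀ {ℓ j} → ℓ ∈ blocks j → runIndex ℓ ≡ toℕ j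
  ∈blocks {j = j} = ∈-subsetOf (λ ℓ → runIndex ℓ ℕ.≟ toℕ j)

  blocks-∈ : ∀ {ℓ j} → runIndex ℓ ≡ toℕ j → ℓ ∈ blocks j
  blocks-∈ {j = j} = subsetOf-∈ (λ ℓ → runIndex ℓ ℕ.≟ toℕ j)

  run-end : ∀ j → ∃[ e ] IsEnd e × rank isEnd? e ≡ toℕ j
  run-end j = rank-surjective isEnd? (subst (toℕ j ℕ.<_) (sym #ends≡m) (toℕ<n j))

  endOf : Fin m → Fin n
  endOf j = proj₁ (run-end j)

  endOf-unique : ∀ {j e} → IsEnd e → rank isEnd? e ≡ toℕ j → endOf j ≡ e
  endOf-unique {j} e-end re≡j =
    rank-injective isEnd? (proj₁ (proj₂ (run-end j))) e-end (trans (proj₂ (proj₂ (run-end j))) (sym re≡j))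

  values : Fin m → Fin n
  values j = f (endOf j)

  run-step : ∀ {ℓ j} → HasNext ℓ → ℓ ∈ blocks j → f ℓ ∈ blocks j
  run-step next ℓ∈ = blocks-∈ (trans (cong (rank isEnd?) (end-step next)) (∈blocks ℓ∈))

  same-end : ∀ {a b j} → a ∈ blocks j → b ∈ blocks j → end a ≡ end b
  same-end a∈ b∈ = rank-injective isEnd? (end-isEnd _) (end-isEnd _) (trans (∈blocks a∈) (sym (∈blocks b∈)))

  max-isEnd : ∀ {a j} → IsMax (blocks j) a → IsEnd a × rank isEnd? a ≡ toℕ j
  max-isEnd {a} (a∈ , a-max) = subst IsEnd end≡a (end-isEnd a) , trans (cong (rank isEnd?) (sym end≡a)) (∈blocks a∈)
    where
    end∈ : end a ∈ blocks _
    end∈ = blocks-∈ (trans (cong (rank isEnd?) (end-of-end (end-isEnd a))) (∈blocks a∈))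
    end≡a : end a ≡ a
    end≡a = toℕ-injective (ℕP.≤-antisym (a-max _ end∈) (end-≥ a))

  endOf-max : ∀ {a j} → IsMax (blocks j) a → endOf j ≡ a
  endOf-max a-max = endOf-unique (proj₁ (max-isEnd a-max)) (proj₂ (max-isEnd a-max))

  partition : IsOrderedPartition blocks
  partition = nonempty , cover , disjoint , order
    where
    nonempty : ∀ j → Nonempty (blocks j)
    nonempty j = let (e , e-end , re≡j) = run-end j in e , blocks-∈ (trans (cong (rank isEnd?) (end-of-end e-end)) re≡j)
    cover : ∀ ℓ → ∃[ j ] ℓ ∈ blocks j
    cover ℓ = fromℕ< index<m , blocks-∈ (sym (toℕ-fromℕ< index<m))
      where
      index<m : runIndex ℓ ℕ.< m
      index<m = subst (runIndex ℓ ℕ.<_) #ends≡m (rank<count isEnd? (end-isEnd ℓ))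
    disjoint : ∀ j k ℓ → ℓ ∈ blocks j → ℓ ∈ blocks k → j ≡ k
    disjoint j k ℓ ℓ∈j ℓ∈k = toℕ-injective (trans (sym (∈blocks ℓ∈j)) (∈blocks ℓ∈k))
    order : ∀ i j a b → i < j → IsMax (blocks i) a → IsMax (blocks j) b → b < a
    order i j a b i<j a-max b-max =
      rank-<⇒> isEnd? (proj₁ (max-isEnd a-max)) (proj₁ (max-isEnd b-max))
        (subst₂ ℕ._<_ (sym (proj₂ (max-isEnd a-max))) (sym (proj₂ (max-isEnd b-max))) i<j)

  -- If x j = f b (b the maximum of block j) were the least element c of block
  -- i above b, the last preimage p of c below c would lie in block i with b < p < c.
  admissible : IsAdmissible blocks values
  admissible i j b c i<j b-max (c∈ , b<c , c-least) xj≡c = no-preimage-between (last-preimage fb≡c b<c)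
    where
    fb≡c : f b ≡ c
    fb≡c = trans (cong f (sym (endOf-max b-max))) xj≡c
    no-preimage-between : ∃[ p ] HasNext p × f p ≡ c × b F.≤ p → ⊥
    no-preimage-between (p , next-p , fp≡c , b≤p) = ℕP.<⇒≱ p<c (c-least p p∈ b<p)
      where
      p<c : p < c
      p<c = subst (p <_) fp≡c (proj₁ next-p)
      b<p : b < p
      b<p = ℕP.≤∧≢⇒< b≤p (λ b≡p → proj₁ (max-isEnd b-max) (subst HasNext (sym (toℕ-injective b≡p)) next-p))
      p∈ : p ∈ blocks i
      p∈ = blocks-∈ (trans (cong (rank isEnd?) (trans (sym (end-step next-p)) (cong end fp≡c))) (∈blocks c∈))

  -- f encodes its pair: run steps go to the next element of the block
  -- (no-skipped), and block maxima are run ends.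
  encodes : Encodes f blocks values
  encodes = record { at-max = λ ℓ-max → cong f (sym (endOf-max ℓ-max)) ; below-max = below-max′ }
    where
    below-max′ : ∀ {j ℓ} → ℓ ∈ blocks j → ¬ IsMax (blocks j) ℓ → IsMinAbove (blocks j) ℓ (f ℓ)
    below-max′ {j} {ℓ} ℓ∈ not-max with hasNext? ℓ
    ... | yes next = run-step next ℓ∈ , proj₁ next , λ d d∈ ℓ<d → no-skipped (same-end ℓ∈ d∈) ℓ<d next
    ... | no ℓ-end = contradiction (ℓ∈ , λ b b∈ → subst (b F.≤_) (trans (same-end b∈ ℓ∈) (end-of-end ℓ-end)) (end-≥ b)) not-max

-- Admissibility of x says
-- precisely that the run steps of f are the steps inside blocks, so the runs
-- of f are the blocks of S and RunPartition gives back (S , x).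
module Decoding {n m} {S : Fin m → Subset n} {x : Fin m → Fin n}
                (partition : IsOrderedPartition S) (admissible : IsAdmissible S x)
                {f : Mapping n} (enc : Encodes f S x) where
  open Runs f

  cover : ∀ ℓ → ∃[ j ] ℓ ∈ S j
  cover = proj₁ (proj₂ partition)

  disjoint : ∀ j k ℓ → ℓ ∈ S j → ℓ ∈ S k → j ≡ k
  disjoint = proj₁ (proj₂ (proj₂ partition))

  order : ∀ i j a b → i < j → IsMax (S i) a → IsMax (S j) b → b < a
  order = proj₂ (proj₂ (proj₂ partition))

  block : Fin n → Fin m
  block ℓ = proj₁ (cover ℓ)

  in-block : ∀ ℓ → ℓ ∈ S (block ℓ)
  in-block ℓ = proj₂ (cover ℓ)

  block-unique : ∀ {ℓ j} → ℓ ∈ S j → block ℓ ≡ j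
  block-unique ℓ∈ = disjoint _ _ _ (in-block _) ℓ∈

  Max : Fin m → Fin n
  Max j = proj₁ (maximum (S j) (proj₁ partition j))

  Max-isMax : ∀ j → IsMax (S j) (Max j)
  Max-isMax j = proj₂ (maximum (S j) (proj₁ partition j))

  Max-injective : Injective _≡_ _≡_ Max
  Max-injective eq = trans (sym (block-unique (proj₁ (Max-isMax _)))) (trans (cong block eq) (block-unique (proj₁ (Max-isMax _))))

  max-order⁻¹ : ∀ {i j a b} → IsMax (S i) a → IsMax (S j) b → b < a → i < j
  max-order⁻¹ {i} {j} a-max b-max b<a with ℕP.<-cmp (toℕ i) (toℕ j)
  ... | tri< i<j _ _ = i<j
  ... | tri≈ _ i≡j _ = contradiction (cong toℕ (max-unique b-max (subst (λ k → IsMax (S k) _) (toℕ-injective i≡j) a-max))) (ℕP.<⇒≢ b<a)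
  ... | tri> _ _ j<i = contradiction b<a (ℕP.<⇒≯ (order j i _ _ j<i b-max a-max))

  block-predecessor : ∀ {j c v} → c ∈ S j → v ∈ S j → c < v → ∃[ p ] c F.≤ p × p < v × f p ≡ v
  block-predecessor {j} {c} {v} c∈ v∈ c<v with largest (λ q → (q ∈? S j) ×-dec (q <? v)) (c∈ , c<v)
  ... | p , (p∈ , p<v) , p-largest =
    p , p-largest c (c∈ , c<v) , p<v , minAbove-unique (below-max enc p∈ p-not-max) (v∈ , p<v , v-least)
    where
    p-not-max : ¬ IsMax (S j) p
    p-not-max (_ , p-max) = ℕP.<⇒≱ p<v (p-max v v∈)
    v-least : ∀ d → d ∈ S j → p < d → v F.≤ d
    v-least d d∈ p<d = ℕP.≮⇒≥ (λ d<v → ℕP.<⇒≱ p<d (p-largest d (d∈ , d<v)))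

  -- A non-maximal element steps inside its block: an element i strictly
  -- between ℓ and c = f ℓ with the same image would contradict either the
  -- minimality of c (i in the block of ℓ) or admissibility (i a block maximum).
  below-max⇒HasNext : ∀ {j ℓ} → ℓ ∈ S j → ¬ IsMax (S j) ℓ → HasNext ℓ
  below-max⇒HasNext {j} {ℓ} ℓ∈ not-max with below-max enc ℓ∈ not-max
  ... | c∈ , ℓ<c , c-least = ℓ<c , λ i ℓ<i i<c fi≡c → no-preimage i ℓ<i i<c fi≡c (isMax? (S (block i)) i)
    where
    no-preimage : ∀ i → ℓ < i → i < f ℓ → f i ≡ f ℓ → Dec (IsMax (S (block i)) i) → ⊥
    no-preimage i ℓ<i i<c fi≡c (yes i-max) =
      admissible j (block i) i (f ℓ) j<bi i-max (c∈ , i<c , λ d d∈ i<d → c-least d d∈ (ℕP.<-trans ℓ<i i<d))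
        (trans (sym (at-max enc i-max)) fi≡c)
      where
      j<bi : j < block i
      j<bi = max-order⁻¹ (Max-isMax j) i-max (ℕP.<-≤-trans i<c (proj₂ (Max-isMax j) (f ℓ) c∈))
    no-preimage i ℓ<i i<c fi≡c (no i-not-max) = ℕP.<⇒≱ i<c (c-least i i∈ ℓ<i)
      where
      c∈bi : f ℓ ∈ S (block i)
      c∈bi = subst (_∈ S (block i)) fi≡c (proj₁ (below-max enc (in-block i) i-not-max))
      i∈ : i ∈ S j
      i∈ = subst (λ k → i ∈ S k) (disjoint _ _ (f ℓ) c∈bi c∈) (in-block i)

  -- A block maximum ends its run: otherwise let c be the least element above ℓ
  -- in the block of v = f ℓ = x j.  Admissibility gives c ≠ v, so the block
  -- predecessor of v is a preimage of v strictly between ℓ and v.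
  max⇒IsEnd : ∀ {j ℓ} → IsMax (S j) ℓ → IsEnd ℓ
  max⇒IsEnd {j} {ℓ} ℓ-max (ℓ<v , ℓ-last)
    with smallest (λ d → (d ∈? S (block (f ℓ))) ×-dec (ℓ <? d)) (in-block (f ℓ) , ℓ<v)
  ... | c , (c∈ , ℓ<c) , c-least =
    let (p , c≤p , p<v , fp≡v) = block-predecessor c∈ (in-block (f ℓ)) c<v
    in ℓ-last p (ℕP.<-≤-trans ℓ<c c≤p) p<v fp≡v
    where
    b<j : block (f ℓ) < j
    b<j = max-order⁻¹ (Max-isMax _) ℓ-max (ℕP.<-≤-trans ℓ<v (proj₂ (Max-isMax _) (f ℓ) (in-block (f ℓ))))
    c-minAbove : IsMinAbove (S (block (f ℓ))) ℓ c
    c-minAbove = c∈ , ℓ<c , λ d d∈ ℓ<d → c-least d (d∈ , ℓ<d)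
    c<v : c < f ℓ
    c<v = ℕP.≤∧≢⇒< (c-least (f ℓ) (in-block (f ℓ) , ℓ<v))
      (λ c≡v → admissible _ j ℓ c b<j ℓ-max c-minAbove (trans (sym (at-max enc ℓ-max)) (sym (toℕ-injective c≡v))))

  end≡Max : ∀ ℓ → end ℓ ≡ Max (block ℓ)
  end≡Max ℓ = end-unique (reaches-Max ℓ (>-wellFounded ℓ)) (max⇒IsEnd (Max-isMax (block ℓ)))
    where
    reaches-Max : ∀ ℓ → Acc _>_ ℓ → ℓ ⇝ Max (block ℓ)
    reaches-Max ℓ (acc rec) with isMax? (S (block ℓ)) ℓ
    ... | yes ℓ-max  = subst (ℓ ⇝_) (max-unique ℓ-max (Max-isMax _)) stop
    ... | no not-max = step next (subst (λ k → f ℓ ⇝ Max k) (block-unique fℓ∈) (reaches-Max (f ℓ) (rec (proj₁ next))))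
      where
      next : HasNext ℓ
      next = below-max⇒HasNext (in-block ℓ) not-max
      fℓ∈ : f ℓ ∈ S (block ℓ)
      fℓ∈ = proj₁ (below-max enc (in-block ℓ) not-max)

  IsEnd⇒Max : ∀ {e} → IsEnd e → e ≡ Max (block e)
  IsEnd⇒Max {e} e-end = trans (sym (end-of-end e-end)) (end≡Max e)

  -- The run ends are exactly the m block maxima …
  runs : ascRuns f ≡ m
  runs = trans ascRuns≡#ends (count-enumerated isEnd? Max (λ j → max⇒IsEnd (Max-isMax j)) Max-injective
    (λ {e} e-end → block e , sym (IsEnd⇒Max e-end)))

  -- … and the ends above Max j are the maxima of the blocks before j.
  rank-Max : ∀ j → rank isEnd? (Max j) ≡ toℕ j
  rank-Max j = count-enumerated (λ k → (Max j <? k) ×-dec isEnd? k) (λ i → Max (F.inject i)) above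
    (λ eq → toℕ-injective (trans (sym (toℕ-inject _)) (trans (cong toℕ (Max-injective eq)) (toℕ-inject _)))) onto
    where
    above : ∀ i → Max j < Max (F.inject i) × IsEnd (Max (F.inject i))
    above i = order (F.inject i) j _ _ (subst (ℕ._< toℕ j) (sym (toℕ-inject i)) (toℕ<n i)) (Max-isMax _) (Max-isMax j)
            , max⇒IsEnd (Max-isMax _)
    onto : ∀ {e} → Max j < e × IsEnd e → ∃[ i ] Max (F.inject i) ≡ e
    onto {e} (Max<e , e-end) = fromℕ< be<j , trans (cong Max inject≡be) (sym (IsEnd⇒Max e-end))
      where
      be<j : toℕ (block e) ℕ.< toℕ j
      be<j = max-order⁻¹ (subst (IsMax (S (block e))) (sym (IsEnd⇒Max e-end)) (Max-isMax (block e))) (Max-isMax j) Max<e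
      inject≡be : F.inject (fromℕ< be<j) ≡ block e
      inject≡be = toℕ-injective (trans (toℕ-inject _) (toℕ-fromℕ< be<j))

  recovers : (runs′ : ascRuns f ≡ m) →
    (∀ j → RunPartition.blocks f runs′ j ≡ S j) × (∀ j → RunPartition.values f runs′ j ≡ x j)
  recovers runs′ = blocks≡ , values≡
    where
    open RunPartition f runs′ using (blocks; ∈blocks; blocks-∈; runIndex; endOf-unique; values)
    runIndex≡block : ∀ ℓ → runIndex ℓ ≡ toℕ (block ℓ)
    runIndex≡block ℓ = trans (cong (rank isEnd?) (end≡Max ℓ)) (rank-Max (block ℓ))
    blocks≡ : ∀ j → blocks j ≡ S j
    blocks≡ j = ⊆-antisym
      (λ {ℓ} ℓ∈ → subst (λ k → ℓ ∈ S k) (toℕ-injective (trans (sym (runIndex≡block ℓ)) (∈blocks ℓ∈))) (in-block ℓ))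
      (λ {ℓ} ℓ∈ → blocks-∈ (trans (runIndex≡block ℓ) (cong toℕ (block-unique ℓ∈))))
    values≡ : ∀ j → values j ≡ x j
    values≡ j = trans (cong f (endOf-unique (max⇒IsEnd (Max-isMax j)) (rank-Max j))) (at-max enc (Max-isMax j))

module _ (n m : ℕ) where
  open Setoid (MappingsWithRunsSetoid n m) using () renaming (_≈_ to _≈ᴹ_)
  open Setoid (PairsSetoid n m) using () renaming (_≈_ to _≈ᴾ_)

  toPair : MappingsWithRuns n m → Pairs n m
  toPair (f , runs) = (blocks , values) , (partition , admissible)
    where open RunPartition f runs

  blocksOf : Pairs n m → Fin m → Subset n
  blocksOf p = proj₁ (proj₁ p)

  valuesOf : Pairs n m → Fin m → Fin n
  valuesOf p = proj₂ (proj₁ p)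

  partitionOf : (p : Pairs n m) → IsOrderedPartition (blocksOf p)
  partitionOf p = proj₁ (proj₂ p)

  toPair-encoded : ∀ a → Encodes (proj₁ a) (blocksOf (toPair a)) (valuesOf (toPair a))
  toPair-encoded (f , runs) = RunPartition.encodes f runs

  encoded⇒toPair : ∀ a p → Encodes (proj₁ a) (blocksOf p) (valuesOf p) → toPair a ≈ᴾ p
  encoded⇒toPair (f , runs) (_ , (partition , admissible)) enc = Decoding.recovers partition admissible enc runs

  bijection : Bijection (MappingsWithRunsSetoid n m) (PairsSetoid n m)
  bijection = record
    { to        = toPair
    ; cong      = λ {a} {b} → congruent {a} {b}
    ; bijective = (λ {a} {b} → injective {a} {b}) , surjective
    }
    where
    congruent : ∀ {a b} → a ≈ᴹ b → toPair a ≈ᴾ toPair b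
    congruent {a} {b} a≈b = encoded⇒toPair a (toPair b)
      (encodes-resp (λ ℓ → sym (a≈b ℓ)) (λ _ → refl) (λ _ → refl) (toPair-encoded b))
    injective : ∀ {a b} → toPair a ≈ᴾ toPair b → a ≈ᴹ b
    injective {a} {b} (blocks≡ , values≡) = encoding-unique (proj₁ (proj₂ (partitionOf (toPair a)))) (toPair-encoded a)
      (encodes-resp (λ _ → refl) (λ j → sym (blocks≡ j)) (λ j → sym (values≡ j)) (toPair-encoded b))
    surjective : ∀ p → ∃[ a ] (∀ {z} → z ≈ᴹ a → toPair z ≈ᴾ p)
    surjective p@((S , x) , (partition , admissible)) = preimage (encoding partition)
      where
      preimage : ∃[ f ] Encodes f S x → ∃[ a ] (∀ {z} → z ≈ᴹ a → toPair z ≈ᴾ p)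
      preimage (f , enc) = (f , Decoding.runs partition admissible enc) ,
        λ {z} z≈f → encoded⇒toPair z p (encodes-resp (λ ℓ → sym (z≈f ℓ)) (λ _ → refl) (λ _ → refl) enc)

mainTheorem5 : (n m : ℕ) → 1 ≤ n → 1 ≤ m →
    Bijection (MappingsWithRunsSetoid n m) (PairsSetoid n m)
mainTheorem5 n m _ _ = bijection n m
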